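{- Let $p\in\mathrm{OFS}(\mathbb{Z}^+)$ and let $k\ge fw(p)$. Then $G(p,k)$ has exactly $d=\gcd(p)$ connected components, namely the congruence classes modulo $d$ of the interval $\{1,2,\ldots,k\}$.
   Context: $\mathrm{OFS}(\mathbb{Z}^+)$ denotes the set of all nonempty strictly increasing finite sequences of positive integers. For $p\in\mathrm{OFS}(\mathbb{Z}^+)$, $|p|$ is its length, $p_i$ its $i$-th entry, $p|_i=(p_1,\ldots,p_i)$, $\gcd(p)$ the gcd of its entries, $\max(p)=p_{|p|}$. The map $R$: $R(p)=p$ if $|p|=1$; if $n=|p|>1$, form $(p_2-p_1,\ldots,p_n-p_1)$ and, if $p_1$ does not appear in it, insert $p_1$ so that the result is strictly increasing. $f$ is defined recursively by $f(p)=p_1$ if $|p|=1$ and $f(p)=p_1+f(R(p))$ if $|p|>1$. $fw$ is defined by: if $n=|p|>1$, $\gcd(p|_{n-1})=\gcd(p)$ and $\max(p)\ge f(p|_{n-1})$, then $fw(p)=fw(p|_{n-1})$; otherwise $fw(p)=f(p)$. For a positive integer $k$, $G(p,k)$ is the simple graph with vertex set $\{1,\ldots,k\}$ and edges $\{i,j\}$ with $|i-j|=p_t$ for some $t$. -}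

module Defs where

open import Data.Nat using (ℕ; zero; suc; _+_; _∸_; _≤_; _<_; _<ᵇ_; _≡ᵇ_; _⊔_; ∣_-_∣)
open import Data.Nat.Properties using (_≟_; _≤?_)
open import Data.Nat.GCD using (gcd)
open import Data.Bool using (if_then_else_; _∧_)
open import Data.List using (List; []; _∷_; map; foldr; length)
open import Data.List.Relation.Unary.All using (All)
open import Data.List.Relation.Unary.Linked using (Linked)
open import Data.List.Membership.Propositional using (_∈_)
open import Data.Product using (_×_)
open import Relation.Binary.PropositionalEquality using (_≡_; _≢_)
open import Relation.Nullary using (does)

IsOFS : List ℕ → Set
IsOFS p = (p ≢ []) × All (1 ≤_) p × Linked _<_ p

gcdL : List ℕ → ℕ
gcdL = foldr gcd 0

maxL : List ℕ → ℕ
maxL = foldr _⊔_ 0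

dropLast : List ℕ → List ℕ
dropLast []           = []
dropLast (x ∷ [])     = []
dropLast (x ∷ y ∷ ys) = x ∷ dropLast (y ∷ ys)

insert : ℕ → List ℕ → List ℕ
insert x []       = x ∷ []
insert x (y ∷ ys) =
  if x <ᵇ y then x ∷ y ∷ ys
  else if x ≡ᵇ y then y ∷ ys
  else y ∷ insert x ys

R : List ℕ → List ℕ
R []           = []
R (x ∷ [])     = x ∷ []
R (x ∷ y ∷ ys) = insert x (map (λ z → z ∸ x) (y ∷ ys))

-- f, computed with fuel; for an OFS p the max strictly decreases under R
-- (when |p| > 1), so fuel suc (maxL p) suffices and f p agrees with the
-- recursive definition f(p) = p₁ (|p| = 1), f(p) = p₁ + f(R p) (|p| > 1).
fFuel : ℕ → List ℕ → ℕ
fFuel zero    _            = 0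
fFuel (suc n) []           = 0
fFuel (suc n) (x ∷ [])     = x
fFuel (suc n) (x ∷ y ∷ ys) = x + fFuel n (R (x ∷ y ∷ ys))

f : List ℕ → ℕ
f p = fFuel (suc (maxL p)) p

fwFuel : ℕ → List ℕ → ℕ
fwFuel zero    p = f p
fwFuel (suc n) p =
  if (1 <ᵇ length p) ∧ does (gcdL (dropLast p) ≟ gcdL p)
                     ∧ does (f (dropLast p) ≤? maxL p)
  then fwFuel n (dropLast p)
  else f p

fw : List ℕ → ℕ
fw p = fwFuel (length p) p

Adj : List ℕ → ℕ → ℕ → ℕ → Set
Adj p k i j = 1 ≤ i × i ≤ k × 1 ≤ j × j ≤ k × ∣ i - j ∣ ∈ p

module Submission where

-- One direction is immediate: every edge has a length in p, and d divides
-- every entry of p, so walks preserve the residue modulo d.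
--
-- The converse is proved for f first, by induction along R.  Write
-- p = x ∷ ys (x < ys) and q = R p.  Each edge of G(q,k) becomes a walk of
-- G(p,k+x): an edge of length x is an edge of G(p,k+x), and an edge of
-- length w ∸ x (w ∈ ys) is the detour u → u + w → u + w ∸ x.  Every vertex
-- of G(p,k+x) is joined by at most one x-step to a vertex of {1,…,k}, and
-- gcd q divides gcd p.  Hence "G(q,k) links congruent vertices" implies
-- "G(p,k+x) links congruent vertices"; since f(p) = x + f(q) and
-- x ≤ max q ≤ f(q), applying this to k ∸ x for k ≥ f(p) closes the induction
-- on max p (the base case p = (x) is a walk in steps of x).  Finally fw only
-- drops last entries that keep the gcd, and dropping entries only removes
-- edges, so the statement for fw follows from the one for f.

open import Defs
open import Data.Nat using (ℕ; zero; suc; _+_; _*_; _∸_; _≤_; _<_; z≤n; s≤s; _<ᵇ_; _≡ᵇ_; _≤ᵇ_; ∣_-_∣; >-nonZero)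
open import Data.Nat.Properties
open import Data.Nat.Divisibility using (_∣_; divides; ∣-trans; ∣-refl; ∣m+n∣m⇒∣n; ∣m∣n⇒∣m+n; ∣⇒≤; _∣0; 0∣⇒≡0)
open import Data.Nat.GCD using (gcd; gcd[m,n]∣m; gcd[m,n]∣n; gcd-greatest)
open import Data.List using (List; []; _∷_; map; length)
open import Data.List.Relation.Unary.Any using (here; there)
open import Data.List.Relation.Unary.All as All using (All; []; _∷_)
open import Data.List.Relation.Unary.All.Properties using (map⁺)
open import Data.List.Relation.Unary.AllPairs using (AllPairs; []; _∷_)
open import Data.List.Relation.Unary.Linked.Properties using (Linked⇒AllPairs)
open import Data.List.Relation.Binary.Subset.Propositional using (_⊆_)
open import Data.List.Membership.Propositional using (_∈_)
open import Data.List.Membership.Propositional.Properties using (∈-map⁻; ∈-map⁺)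
open import Data.Product using (_×_; _,_; proj₁; proj₂; ∃)
open import Data.Sum using (_⊎_; inj₁; inj₂)
open import Data.Bool using (T; true; false)
open import Data.Bool.Properties using (T-≡)
open import Function.Bundles using (_⇔_; Equivalence; mk⇔)
open import Relation.Binary.PropositionalEquality using (_≡_; _≢_; refl; sym; trans; cong; subst; module ≡-Reasoning)
open import Relation.Nullary using (yes; no)
open import Relation.Binary.Construct.Closure.ReflexiveTransitive using (Star; ε; _◅_; _◅◅_)
import Relation.Binary.Construct.Closure.ReflexiveTransitive as Star

Congruent : ℕ → ℕ → ℕ → Set
Congruent d a b = d ∣ ∣ a - b ∣

dist-split : ∀ a b → b ≡ a + ∣ a - b ∣ ⊎ a ≡ b + ∣ a - b ∣
dist-split zero    b       = inj₁ refl
dist-split (suc a) zero    = inj₂ refl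
dist-split (suc a) (suc b) with dist-split a b
... | inj₁ e = inj₁ (cong suc e)
... | inj₂ e = inj₂ (cong suc e)

multiples-congruent : ∀ {d} a b → d ∣ a → d ∣ b → Congruent d a b
multiples-congruent a b d∣a d∣b with dist-split a b
... | inj₁ e = ∣m+n∣m⇒∣n (subst (_ ∣_) e d∣b) d∣a
... | inj₂ e = ∣m+n∣m⇒∣n (subst (_ ∣_) e d∣a) d∣b

congruent-multiple : ∀ {d} a b → d ∣ a → Congruent d a b → d ∣ b
congruent-multiple {d} a b d∣a d∣δ with dist-split a b
... | inj₁ e = subst (d ∣_) (sym e) (∣m∣n⇒∣m+n d∣a d∣δ)
... | inj₂ e = ∣m+n∣m⇒∣n (subst (d ∣_) (trans e (+-comm b _)) d∣a) d∣δ

congruent-refl : ∀ {d} a → Congruent d a a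
congruent-refl {d} a = subst (d ∣_) (sym (∣n-n∣≡0 a)) (d ∣0)

congruent-sym : ∀ {d} a b → Congruent d a b → Congruent d b a
congruent-sym {d} a b = subst (d ∣_) (∣-∣-comm a b)

congruent-trans : ∀ {d} a b c → Congruent d a b → Congruent d b c → Congruent d a c
congruent-trans zero    b       c       d∣b d∣δ = congruent-multiple b c d∣b d∣δ
congruent-trans (suc a) zero    c       d∣a d∣c = multiples-congruent (suc a) c d∣a d∣c
congruent-trans (suc a) (suc b) zero    d∣δ d∣b =
  congruent-multiple (suc b) (suc a) d∣b (congruent-sym (suc a) (suc b) d∣δ)
congruent-trans (suc a) (suc b) (suc c) d∣δ d∣δ′ = congruent-trans a b c d∣δ d∣δ′

∈⇒≤max : ∀ {z} L → z ∈ L → z ≤ maxL L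
∈⇒≤max (a ∷ L) (here refl) = m≤m⊔n a (maxL L)
∈⇒≤max (a ∷ L) (there z∈L) = ≤-trans (∈⇒≤max L z∈L) (m≤n⊔m a (maxL L))

max≤ : ∀ {m} L → All (_≤ m) L → maxL L ≤ m
max≤ []      []       = z≤n
max≤ (a ∷ L) (a≤ ∷ L≤) = ⊔-lub a≤ (max≤ L L≤)

max< : ∀ {m} L → 0 < m → All (_< m) L → maxL L < m
max< []      0<m []       = 0<m
max< (a ∷ L) 0<m (a< ∷ L<) = ⊔-lub a< (max< L 0<m L<)

gcd∣∈ : ∀ {z} L → z ∈ L → gcdL L ∣ z
gcd∣∈ (a ∷ L) (here refl) = gcd[m,n]∣m a (gcdL L)
gcd∣∈ (a ∷ L) (there z∈L) = ∣-trans (gcd[m,n]∣n a (gcdL L)) (gcd∣∈ L z∈L)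

gcd-greatestL : ∀ {d} L → All (d ∣_) L → d ∣ gcdL L
gcd-greatestL []      []           = _ ∣0
gcd-greatestL (a ∷ L) (d∣a ∷ d∣L) = gcd-greatest d∣a (gcd-greatestL L d∣L)

Ascending : List ℕ → Set
Ascending p = All (1 ≤_) p × AllPairs _<_ p

insert-cases : ∀ x y ys →
    (x < y × insert x (y ∷ ys) ≡ x ∷ y ∷ ys)
  ⊎ (x ≡ y × insert x (y ∷ ys) ≡ y ∷ ys)
  ⊎ (y < x × insert x (y ∷ ys) ≡ y ∷ insert x ys)
insert-cases x y ys with x <ᵇ y in x<ᵇy
... | true = inj₁ (<ᵇ⇒< x y (Equivalence.from T-≡ x<ᵇy) , refl)
... | false with x ≡ᵇ y in x≡ᵇy
...   | true  = inj₂ (inj₁ (≡ᵇ⇒≡ x y (Equivalence.from T-≡ x≡ᵇy) , refl))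
...   | false = inj₂ (inj₂ (≤∧≢⇒< y≤x y≢x , refl))
  where
  y≤x : y ≤ x
  y≤x = ≮⇒≥ (λ x<y → subst T x<ᵇy (<⇒<ᵇ x<y))
  y≢x : y ≢ x
  y≢x y≡x = subst T x≡ᵇy (≡⇒≡ᵇ x y (sym y≡x))

∈-insert⁻ : ∀ x L {z} → z ∈ insert x L → z ≡ x ⊎ z ∈ L
∈-insert⁻ x []       (here z≡x) = inj₁ z≡x
∈-insert⁻ x (y ∷ ys) {z} z∈ with insert-cases x y ys
... | inj₁ (_ , e) with subst (z ∈_) e z∈
...   | here z≡x = inj₁ z≡x
...   | there z∈L = inj₂ z∈L
∈-insert⁻ x (y ∷ ys) {z} z∈ | inj₂ (inj₁ (_ , e)) = inj₂ (subst (z ∈_) e z∈)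
∈-insert⁻ x (y ∷ ys) {z} z∈ | inj₂ (inj₂ (_ , e)) with subst (z ∈_) e z∈
...   | here z≡y = inj₂ (here z≡y)
...   | there z∈ins with ∈-insert⁻ x ys z∈ins
...     | inj₁ z≡x  = inj₁ z≡x
...     | inj₂ z∈ys = inj₂ (there z∈ys)

∈-insert-new : ∀ x L → x ∈ insert x L
∈-insert-new x [] = here refl
∈-insert-new x (y ∷ ys) with insert-cases x y ys
... | inj₁ (_ , e)          = subst (x ∈_) (sym e) (here refl)
... | inj₂ (inj₁ (x≡y , e)) = subst (x ∈_) (sym e) (here x≡y)
... | inj₂ (inj₂ (_ , e))   = subst (x ∈_) (sym e) (there (∈-insert-new x ys))

∈-insert-old : ∀ x L {z} → z ∈ L → z ∈ insert x L
∈-insert-old x (y ∷ ys) {z} z∈ with insert-cases x y ys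
... | inj₁ (_ , e)        = subst (z ∈_) (sym e) (there z∈)
... | inj₂ (inj₁ (_ , e)) = subst (z ∈_) (sym e) z∈
∈-insert-old x (y ∷ ys) {z} (here z≡y)  | inj₂ (inj₂ (_ , e)) = subst (z ∈_) (sym e) (here z≡y)
∈-insert-old x (y ∷ ys) {z} (there z∈)  | inj₂ (inj₂ (_ , e)) =
  subst (z ∈_) (sym e) (there (∈-insert-old x ys z∈))

insert-sorted : ∀ x L → AllPairs _<_ L → AllPairs _<_ (insert x L)
insert-sorted x []       [] = [] ∷ []
insert-sorted x (y ∷ ys) (y< ∷ ys-sorted) with insert-cases x y ys
... | inj₁ (x<y , e) =
  subst (AllPairs _<_) (sym e) ((x<y ∷ All.map (<-trans x<y) y<) ∷ y< ∷ ys-sorted)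
... | inj₂ (inj₁ (_ , e)) = subst (AllPairs _<_) (sym e) (y< ∷ ys-sorted)
... | inj₂ (inj₂ (y<x , e)) =
  subst (AllPairs _<_) (sym e) (All.tabulate y<ins ∷ insert-sorted x ys ys-sorted)
  where
  y<ins : ∀ {z} → z ∈ insert x ys → y < z
  y<ins z∈ with ∈-insert⁻ x ys z∈
  ... | inj₁ refl = y<x
  ... | inj₂ z∈ys = All.lookup y< z∈ys

∸-sorted : ∀ x L → All (x <_) L → AllPairs _<_ L → AllPairs _<_ (map (λ z → z ∸ x) L)
∸-sorted x []       []         []               = []
∸-sorted x (z ∷ zs) (x<z ∷ x<zs) (z< ∷ zs-sorted) =
  map⁺ (All.map (λ z<w → ∸-monoˡ-< z<w (<⇒≤ x<z)) z<) ∷ ∸-sorted x zs x<zs zs-sorted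

∈-R-head : ∀ x y ys → x ∈ R (x ∷ y ∷ ys)
∈-R-head x y ys = ∈-insert-new x (map (λ z → z ∸ x) (y ∷ ys))

∈-R-diff : ∀ x y ys {w} → w ∈ y ∷ ys → w ∸ x ∈ R (x ∷ y ∷ ys)
∈-R-diff x y ys w∈ = ∈-insert-old x _ (∈-map⁺ (λ z → z ∸ x) w∈)

∈-R⁻ : ∀ x y ys {z} → z ∈ R (x ∷ y ∷ ys) → z ≡ x ⊎ ∃ λ w → w ∈ y ∷ ys × z ≡ w ∸ x
∈-R⁻ x y ys z∈ with ∈-insert⁻ x _ z∈
... | inj₁ z≡x = inj₁ z≡x
... | inj₂ z∈diffs = inj₂ (∈-map⁻ (λ z → z ∸ x) z∈diffs)

R-ascending : ∀ {x y ys} → Ascending (x ∷ y ∷ ys) → Ascending (R (x ∷ y ∷ ys))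
R-ascending {x} {y} {ys} (1≤x ∷ _ , x<ys ∷ ys-sorted) =
  All.tabulate positive , insert-sorted x _ (∸-sorted x (y ∷ ys) x<ys ys-sorted)
  where
  positive : ∀ {z} → z ∈ R (x ∷ y ∷ ys) → 1 ≤ z
  positive z∈ with ∈-R⁻ x y ys z∈
  ... | inj₁ refl = 1≤x
  ... | inj₂ (w , w∈ , refl) = m<n⇒0<n∸m (All.lookup x<ys w∈)

-- R strictly lowers the maximum; this bounds the recursion defining f.
R-max< : ∀ {x y ys} → 1 ≤ x → All (x <_) (y ∷ ys) → maxL (R (x ∷ y ∷ ys)) < maxL (x ∷ y ∷ ys)
R-max< {x} {y} {ys} 1≤x x<ys = max< _ (<-≤-trans 1≤x (∈⇒≤max p (here refl))) (All.tabulate below)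
  where
  p : List ℕ
  p = x ∷ y ∷ ys
  below : ∀ {z} → z ∈ R p → z < maxL p
  below z∈ with ∈-R⁻ x y ys z∈
  ... | inj₁ refl = <-≤-trans (All.lookup x<ys (here refl)) (∈⇒≤max p (there (here refl)))
  ... | inj₂ (w , w∈ , refl) = <-≤-trans (∸-monoʳ-< 1≤x (<⇒≤ (All.lookup x<ys w∈))) (∈⇒≤max p (there w∈))

-- Each entry w of p is at most x + (w ∸ x), so max p ≤ x + max (R p).
max≤head+maxR : ∀ x y ys → maxL (x ∷ y ∷ ys) ≤ x + maxL (R (x ∷ y ∷ ys))
max≤head+maxR x y ys = ⊔-lub (m≤m+n x _) (max≤ (y ∷ ys) (All.tabulate bound))
  where
  bound : ∀ {w} → w ∈ y ∷ ys → w ≤ x + maxL (R (x ∷ y ∷ ys))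
  bound {w} w∈ = ≤-trans (m≤n+m∸n w x) (+-monoʳ-≤ x (∈⇒≤max _ (∈-R-diff x y ys w∈)))

-- gcd(R p) divides every entry w = (w ∸ x) + x of p, hence gcd p.
gcdR∣gcd : ∀ {x y ys} → All (x <_) (y ∷ ys) → gcdL (R (x ∷ y ∷ ys)) ∣ gcdL (x ∷ y ∷ ys)
gcdR∣gcd {x} {y} {ys} x<ys = gcd-greatestL _ (gcd∣∈ q (∈-R-head x y ys) ∷ All.tabulate divides-entry)
  where
  q : List ℕ
  q = R (x ∷ y ∷ ys)
  divides-entry : ∀ {w} → w ∈ y ∷ ys → gcdL q ∣ w
  divides-entry w∈ = subst (gcdL q ∣_) (m∸n+n≡m (<⇒≤ (All.lookup x<ys w∈)))
    (∣m∣n⇒∣m+n (gcd∣∈ q (∈-R-diff x y ys w∈)) (gcd∣∈ q (∈-R-head x y ys)))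

Reach : List ℕ → ℕ → ℕ → ℕ → Set
Reach p k = Star (Adj p k)

GcdConnected : List ℕ → ℕ → Set
GcdConnected p k = ∀ i j → 1 ≤ i → i ≤ k → 1 ≤ j → j ≤ k → Congruent (gcdL p) i j → Reach p k i j

Adj-sym : ∀ {p k i j} → Adj p k i j → Adj p k j i
Adj-sym {p} {k} {i} {j} (1≤i , i≤k , 1≤j , j≤k , δ∈p) =
  1≤j , j≤k , 1≤i , i≤k , subst (_∈ p) (∣-∣-comm i j) δ∈p

Reach-sym : ∀ {p k i j} → Reach p k i j → Reach p k j i
Reach-sym = Star.reverse Adj-sym

Adj-transfer : ∀ {p p′ k k′ i j} → k ≤ k′ → (∣ i - j ∣ ∈ p → ∣ i - j ∣ ∈ p′) →
               Adj p k i j → Adj p′ k′ i j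
Adj-transfer k≤k′ keep (1≤i , i≤k , 1≤j , j≤k , δ∈p) =
  1≤i , ≤-trans i≤k k≤k′ , 1≤j , ≤-trans j≤k k≤k′ , keep δ∈p

edge : ∀ {p k a i} → a ∈ p → 1 ≤ i → i + a ≤ k → Adj p k i (i + a)
edge {p} {a = a} {i} a∈p 1≤i i+a≤k =
  1≤i , ≤-trans (m≤m+n i a) i+a≤k , ≤-trans 1≤i (m≤m+n i a) , i+a≤k ,
  subst (_∈ p) (sym (∣m-m+n∣≡n i a)) a∈p

reach⇒congruent : ∀ {p k i j} → Reach p k i j → Congruent (gcdL p) i j
reach⇒congruent {p} = Star.fold (Congruent (gcdL p)) step (λ {a} → congruent-refl a)
  where
  step : ∀ {i j l} → Adj p _ i j → Congruent (gcdL p) j l → Congruent (gcdL p) i l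
  step {i} {j} {l} (_ , _ , _ , _ , δ∈p) = congruent-trans i j l (gcd∣∈ p δ∈p)

a-steps : ∀ {p k a} → a ∈ p → ∀ m i → 1 ≤ i → i + m * a ≤ k → Reach p k i (i + m * a)
a-steps {p} {k} a∈p zero i _ _ = subst (Reach p k i) (sym (+-identityʳ i)) ε
a-steps {p} {k} {a} a∈p (suc m) i 1≤i le =
  edge a∈p 1≤i (≤-trans (+-monoʳ-≤ i (m≤m+n a (m * a))) le) ◅
  subst (Reach p k (i + a)) (+-assoc i a (m * a))
    (a-steps a∈p m (i + a) (≤-trans 1≤i (m≤m+n i a)) (subst (_≤ k) (sym (+-assoc i a (m * a))) le))

multiple-walk : ∀ {p k a u δ} → a ∈ p → 1 ≤ u → u + δ ≤ k → a ∣ δ → Reach p k u (u + δ)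
multiple-walk {u = u} a∈p 1≤u le (divides m refl) = a-steps a∈p m u 1≤u le

generator-connects : ∀ {p k a i j} → a ∈ p → 1 ≤ i → i ≤ k → 1 ≤ j → j ≤ k →
                     a ∣ ∣ i - j ∣ → Reach p k i j
generator-connects {p} {k} {i = i} {j} a∈p 1≤i i≤k 1≤j j≤k a∣δ with dist-split i j
... | inj₁ j≡ = subst (Reach p k i) (sym j≡) (multiple-walk a∈p 1≤i (subst (_≤ k) j≡ j≤k) a∣δ)
... | inj₂ i≡ =
  Reach-sym (subst (Reach p k j) (sym i≡) (multiple-walk a∈p 1≤j (subst (_≤ k) i≡ i≤k) a∣δ))

attained-gcd-connected : ∀ {p k a} → a ∈ p → a ∣ gcdL p → GcdConnected p k
attained-gcd-connected a∈p a∣gcd i j 1≤i i≤k 1≤j j≤k g∣δ =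
  generator-connects a∈p 1≤i i≤k 1≤j j≤k (∣-trans a∣gcd g∣δ)

GcdConnected-⊆ : ∀ {q p k} → q ⊆ p → gcdL q ≡ gcdL p → GcdConnected q k → GcdConnected p k
GcdConnected-⊆ q⊆p gq≡gp conn i j 1≤i i≤k 1≤j j≤k g∣δ =
  Star.map (Adj-transfer ≤-refl q⊆p) (conn i j 1≤i i≤k 1≤j j≤k (subst (_∣ _) (sym gq≡gp) g∣δ))

lower : ∀ {p a k} i → a ∈ p → a ≤ k → 1 ≤ i → i ≤ k + a →
        ∃ λ i′ → 1 ≤ i′ × i′ ≤ k × Reach p (k + a) i i′
lower {p} {a} {k} i a∈p a≤k 1≤i i≤k+a with i ≤? k
... | yes i≤k = i , 1≤i , i≤k , ε
... | no  i≰k = i ∸ a , m<n⇒0<n∸m a<i , m≤n+o⇒m∸n≤o i a (subst (i ≤_) (+-comm k a) i≤k+a) , Star.return down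
  where
  a<i : a < i
  a<i = ≤-<-trans a≤k (≰⇒> i≰k)
  i∸a+a≡i : i ∸ a + a ≡ i
  i∸a+a≡i = m∸n+n≡m (<⇒≤ a<i)
  down : Adj p (k + a) i (i ∸ a)
  down = Adj-sym (subst (Adj p (k + a) (i ∸ a)) i∸a+a≡i
           (edge a∈p (m<n⇒0<n∸m a<i) (subst (_≤ k + a) (sym i∸a+a≡i) i≤k+a)))

-- A step of length w ∸ x from u up to v is realised as u → u + w → v = u + w ∸ x.
detour-up : ∀ {p k x w u v} → x ∈ p → w ∈ p → x ≤ w → 1 ≤ u → v ≤ k → v ≡ u + (w ∸ x) →
            Reach p (k + x) u v
detour-up {p} {k} {x} {w} {u} {v} x∈p w∈p x≤w 1≤u v≤k v≡ =
  edge w∈p 1≤u (subst (_≤ k + x) v+x≡u+w v+x≤k+x) ◅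
  Adj-sym (subst (Adj p (k + x) v) v+x≡u+w (edge x∈p 1≤v v+x≤k+x)) ◅ ε
  where
  open ≡-Reasoning
  v+x≡u+w : v + x ≡ u + w
  v+x≡u+w = begin
    v + x             ≡⟨ cong (_+ x) v≡ ⟩
    u + (w ∸ x) + x   ≡⟨ +-assoc u (w ∸ x) x ⟩
    u + (w ∸ x + x)   ≡⟨ cong (u +_) (m∸n+n≡m x≤w) ⟩
    u + w             ∎
  v+x≤k+x : v + x ≤ k + x
  v+x≤k+x = +-monoˡ-≤ x v≤k
  1≤v : 1 ≤ v
  1≤v = ≤-trans 1≤u (subst (u ≤_) (sym v≡) (m≤m+n u (w ∸ x)))

detour : ∀ {p k x w u v} → x ∈ p → w ∈ p → x ≤ w → 1 ≤ u → u ≤ k → 1 ≤ v → v ≤ k →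
         ∣ u - v ∣ ≡ w ∸ x → Reach p (k + x) u v
detour {u = u} {v} x∈p w∈p x≤w 1≤u u≤k 1≤v v≤k δ≡ with dist-split u v
... | inj₁ v≡ = detour-up x∈p w∈p x≤w 1≤u v≤k (trans v≡ (cong (u +_) δ≡))
... | inj₂ u≡ = Reach-sym (detour-up x∈p w∈p x≤w 1≤v u≤k (trans u≡ (cong (v +_) δ≡)))

R-edge-walk : ∀ {x y ys k} → All (x <_) (y ∷ ys) →
              ∀ {u v} → Adj (R (x ∷ y ∷ ys)) k u v → Reach (x ∷ y ∷ ys) (k + x) u v
R-edge-walk {x} {y} {ys} {k} x<ys e@(1≤u , u≤k , 1≤v , v≤k , δ∈R) with ∈-R⁻ x y ys δ∈R
... | inj₁ δ≡x = Star.return (Adj-transfer (m≤m+n k x) (λ _ → subst (_∈ _) (sym δ≡x) (here refl)) e)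
... | inj₂ (w , w∈ , δ≡) =
  detour (here refl) (there w∈) (<⇒≤ (All.lookup x<ys w∈)) 1≤u u≤k 1≤v v≤k δ≡

R-reduction : ∀ {x y ys k} → All (x <_) (y ∷ ys) → x ≤ k →
              GcdConnected (R (x ∷ y ∷ ys)) k → GcdConnected (x ∷ y ∷ ys) (k + x)
R-reduction {x} {y} {ys} {k} x<ys x≤k conn i j 1≤i i≤ 1≤j j≤ i≡j
  with lower i (here refl) x≤k 1≤i i≤ | lower j (here refl) x≤k 1≤j j≤
... | i′ , 1≤i′ , i′≤k , i⇝i′ | j′ , 1≤j′ , j′≤k , j⇝j′ =
  i⇝i′ ◅◅ Star._⋆ (R-edge-walk x<ys) (conn i′ j′ 1≤i′ i′≤k 1≤j′ j′≤k i′≡j′)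
       ◅◅ Reach-sym j⇝j′
  where
  i′≡j′ : Congruent (gcdL (R (x ∷ y ∷ ys))) i′ j′
  i′≡j′ = ∣-trans (gcdR∣gcd x<ys)
    (congruent-trans i′ i j′ (congruent-sym i i′ (reach⇒congruent i⇝i′))
      (congruent-trans i j j′ i≡j (reach⇒congruent j⇝j′)))

max≤fFuel : ∀ n p → Ascending p → maxL p < n → maxL p ≤ fFuel n p
max≤fFuel (suc n) []           _ _ = z≤n
max≤fFuel (suc n) (x ∷ [])     _ _ = ≤-reflexive (⊔-identityʳ x)
max≤fFuel (suc n) (x ∷ y ∷ ys) asc@(1≤x ∷ _ , x<ys ∷ _) (s≤s maxp≤n) =
  ≤-trans (max≤head+maxR x y ys)
    (+-monoʳ-≤ x (max≤fFuel n _ (R-ascending asc) (<-≤-trans (R-max< 1≤x x<ys) maxp≤n)))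

fFuel-connected : ∀ n p → Ascending p → maxL p < n → ∀ k → fFuel n p ≤ k → GcdConnected p k
fFuel-connected (suc n) [] _ _ k _ i j _ _ _ _ 0∣δ =
  subst (Reach [] k i) (∣m-n∣≡0⇒m≡n (0∣⇒≡0 0∣δ)) ε
fFuel-connected (suc n) (x ∷ []) _ _ _ _ =
  attained-gcd-connected (here refl) (gcd-greatest ∣-refl (x ∣0))
fFuel-connected (suc n) (x ∷ y ∷ ys) asc@(1≤x ∷ _ , x<ys ∷ _) (s≤s maxp≤n) k x+F≤k =
  subst (GcdConnected (x ∷ y ∷ ys)) (m∸n+n≡m x≤k)
    (R-reduction x<ys x≤k∸x (fFuel-connected n q (R-ascending asc) maxq<n (k ∸ x) F≤k∸x))
  where
  q : List ℕ
  q = R (x ∷ y ∷ ys)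
  maxq<n : maxL q < n
  maxq<n = <-≤-trans (R-max< 1≤x x<ys) maxp≤n
  F≤k∸x : fFuel n q ≤ k ∸ x
  F≤k∸x = m+n≤o⇒m≤o∸n (fFuel n q) (subst (_≤ k) (+-comm x _) x+F≤k)
  x≤k∸x : x ≤ k ∸ x
  x≤k∸x = ≤-trans (∈⇒≤max q (∈-R-head x y ys)) (≤-trans (max≤fFuel n q (R-ascending asc) maxq<n) F≤k∸x)
  x≤k : x ≤ k
  x≤k = m+n≤o⇒m≤o x x+F≤k

-- gcd p ≤ p₁ ≤ f p.
gcd≤f : ∀ p → Ascending p → gcdL p ≤ f p
gcd≤f []       _              = z≤n
gcd≤f (x ∷ xs) (1≤x ∷ _ , _) = ≤-trans (∣⇒≤ {{>-nonZero 1≤x}} (gcd[m,n]∣m x _)) (head≤f xs)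
  where
  head≤f : ∀ xs → x ≤ f (x ∷ xs)
  head≤f []       = ≤-refl
  head≤f (_ ∷ _)  = m≤m+n x _

Good : List ℕ → ℕ → Set
Good p k = GcdConnected p k × gcdL p ≤ k

f-good : ∀ p → Ascending p → ∀ k → f p ≤ k → Good p k
f-good p asc k f≤k =
  fFuel-connected (suc (maxL p)) p asc ≤-refl k f≤k , ≤-trans (gcd≤f p asc) f≤k

dropLast-⊆ : ∀ p → dropLast p ⊆ p
dropLast-⊆ (x ∷ y ∷ ys) (here z≡x) = here z≡x
dropLast-⊆ (x ∷ y ∷ ys) (there z∈) = there (dropLast-⊆ (y ∷ ys) z∈)

dropLast-sorted : ∀ p → AllPairs _<_ p → AllPairs _<_ (dropLast p)
dropLast-sorted []           _                 = []
dropLast-sorted (x ∷ [])     _                 = []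
dropLast-sorted (x ∷ y ∷ ys) (x< ∷ ys-sorted) =
  All.tabulate (λ z∈ → All.lookup x< (dropLast-⊆ (y ∷ ys) z∈)) ∷ dropLast-sorted (y ∷ ys) ys-sorted

dropLast-ascending : ∀ p → Ascending p → Ascending (dropLast p)
dropLast-ascending p (pos , sorted) =
  All.tabulate (λ z∈ → All.lookup pos (dropLast-⊆ p z∈)) , dropLast-sorted p sorted

fwFuel-good : ∀ n p → Ascending p → ∀ k → fwFuel n p ≤ k → Good p k
fwFuel-good zero    p asc k fw≤k = f-good p asc k fw≤k
fwFuel-good (suc n) p asc k fw≤k
  with 1 <ᵇ length p | gcdL (dropLast p) ≡ᵇ gcdL p in gcd-test | f (dropLast p) ≤ᵇ maxL p
... | true  | true  | true =
  GcdConnected-⊆ (dropLast-⊆ p) same-gcd (proj₁ shorter) , subst (_≤ k) same-gcd (proj₂ shorter)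
  where
  same-gcd : gcdL (dropLast p) ≡ gcdL p
  same-gcd = ≡ᵇ⇒≡ _ _ (Equivalence.from T-≡ gcd-test)
  shorter : Good (dropLast p) k
  shorter = fwFuel-good n (dropLast p) (dropLast-ascending p asc) k fw≤k
... | true  | true  | false = f-good p asc k fw≤k
... | true  | false | _     = f-good p asc k fw≤k
... | false | _     | _     = f-good p asc k fw≤k

corollary25 : (p : List ℕ) → IsOFS p → (k : ℕ) → fw p ≤ k →
    ((i j : ℕ) → 1 ≤ i → i ≤ k → 1 ≤ j → j ≤ k →
    (Star (Adj p k) i j ⇔ gcdL p ∣ ∣ i - j ∣))
    × gcdL p ≤ k
corollary25 p (_ , positive , increasing) k fw≤k =
  (λ i j 1≤i i≤k 1≤j j≤k → mk⇔ reach⇒congruent (connected i j 1≤i i≤k 1≤j j≤k)) , gcd≤k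
  where
  good : Good p k
  good = fwFuel-good (length p) p (positive , Linked⇒AllPairs <-trans increasing) k fw≤k
  connected : GcdConnected p k
  connected = proj₁ good
  gcd≤k : gcdL p ≤ k
  gcd≤k = proj₂ good
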